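{- For $n>0$, the $2$-polygraph $\mathrm{CPC}_2(n)$ is Tietze equivalent to the $2$-polygraph $\mathrm{Knuth}^{\mathrm{cc}}_2(n)$.
   Context: Let $[n]=\{1<\dots<n\}$; a column is a word $x_p\dots x_1$ with $x_p>\dots>x_1$, $\mathrm{col}(n)$ the set of nonempty columns, and $\mathrm{Col}_1(n)=\{c_u\mid u\in\mathrm{col}(n)\}$. Let $\mathrm{CC}_2(n)=\{\gamma_u:c_{x_p}\cdots c_{x_1}\Rightarrow c_u\mid u=x_p\dots x_1\in\mathrm{col}(n),\ p\ge2\}$. $\mathrm{Knuth}^{\mathrm{cc}}_2(n)$ has generators $\mathrm{Col}_1(n)$ and relations $\mathrm{CC}_2(n)$ together with $\eta^c_{x,y,z}:c_zc_xc_y\Rightarrow c_xc_zc_y$ ($1\le x\le y<z\le n$) and $\epsilon^c_{x,y,z}:c_yc_zc_x\Rightarrow c_yc_xc_z$ ($1\le x<y\le z\le n$). $\mathrm{CPC}_2(n)$ has generators $\mathrm{Col}_1(n)$ and relations $\mathrm{CC}_2(n)$ together with $\alpha'_{x,zy}:c_xc_{zy}\Rightarrow c_{zx}c_y$ ($1\le x\le y<z\le n$) and $\alpha'_{y,zx}:c_yc_{zx}\Rightarrow c_{yx}c_z$ ($1\le x<y\le z\le n$). Two $2$-polygraphs are Tietze equivalent if they present isomorphic monoids, where a $2$-polygraph presents the quotient of the free monoid on its generators by the congruence generated by its relations. -}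

module Defs where

open import Level using (0ℓ)
open import Data.Bool using (Bool; true; false; _∧_; T)
open import Data.Nat using (ℕ; _<ᵇ_; _≤_)
open import Data.Fin using (Fin; toℕ) renaming (_≤_ to _≤ᶠ_; _<_ to _<ᶠ_)
open import Data.List using (List; []; _∷_; [_]; _++_; map; length)
open import Data.List.Properties using (++-assoc; ++-identityˡ; ++-identityʳ)
open import Data.Product using (Σ; _,_; ∃)
open import Relation.Binary.PropositionalEquality as P using (_≡_)
open import Algebra.Bundles using (Monoid; RawMonoid)
open import Algebra.Morphism.Structures using (module MonoidMorphisms)

-- Alphabet [n] = {1 < ... < n}, encoded by Fin n (letter i ↦ toℕ i + 1;
-- the order is preserved).  A word x_p … x_1 is the list x_p ∷ … ∷ x_1.

isCol : ∀ {n} → List (Fin n) → Bool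
isCol []              = false
isCol (x ∷ [])        = true
isCol (x ∷ y ∷ w)     = (toℕ y <ᵇ toℕ x) ∧ isCol (y ∷ w)

-- col(n); the generator c_u of Col_1(n) is identified with u ∈ col(n).
-- (T b is a proposition, so c_u depends only on the word u.)
Col : ℕ → Set
Col n = Σ (List (Fin n)) (λ u → T (isCol u))

c1 : ∀ {n} → Fin n → Col n
c1 x = (x ∷ [] , _)

Word : ℕ → Set
Word n = List (Col n)

-- 2-polygraphs with 1-generators Col_1(n): a family of 2-cells (relations)
-- given as a predicate on (source, target) pairs.

Rel2 : ℕ → Set₁
Rel2 n = Word n → Word n → Set

data CC2 {n : ℕ} : Rel2 n where
  γ : (u : List (Fin n)) (p : T (isCol u)) → 2 ≤ length u →
      CC2 (map c1 u) ((u , p) ∷ [])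

data KnuthCC2 {n : ℕ} : Rel2 n where
  cc : ∀ {s t} → CC2 s t → KnuthCC2 s t
  η  : (x y z : Fin n) → x ≤ᶠ y → y <ᶠ z →
       KnuthCC2 (c1 z ∷ c1 x ∷ c1 y ∷ []) (c1 x ∷ c1 z ∷ c1 y ∷ [])
  ε  : (x y z : Fin n) → x <ᶠ y → y ≤ᶠ z →
       KnuthCC2 (c1 y ∷ c1 z ∷ c1 x ∷ []) (c1 y ∷ c1 x ∷ c1 z ∷ [])

data CPC2 {n : ℕ} : Rel2 n where
  cc   : ∀ {s t} → CC2 s t → CPC2 s t
  α'₁  : (x y z : Fin n) → x ≤ᶠ y → y <ᶠ z →
         (pzy : T (isCol (z ∷ y ∷ []))) (pzx : T (isCol (z ∷ x ∷ []))) →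
         CPC2 (c1 x ∷ (z ∷ y ∷ [] , pzy) ∷ []) ((z ∷ x ∷ [] , pzx) ∷ c1 y ∷ [])
  α'₂  : (x y z : Fin n) → x <ᶠ y → y ≤ᶠ z →
         (pzx : T (isCol (z ∷ x ∷ []))) (pyx : T (isCol (y ∷ x ∷ []))) →
         CPC2 (c1 y ∷ (z ∷ x ∷ [] , pzx) ∷ []) ((y ∷ x ∷ [] , pyx) ∷ c1 z ∷ [])

data _⊢_≈_ {n : ℕ} (R : Rel2 n) : Word n → Word n → Set where
  step  : ∀ l {s t} r → R s t → R ⊢ (l ++ s ++ r) ≈ (l ++ t ++ r)
  refl  : ∀ {u} → R ⊢ u ≈ u
  sym   : ∀ {u v} → R ⊢ u ≈ v → R ⊢ v ≈ u
  trans : ∀ {u v w} → R ⊢ u ≈ v → R ⊢ v ≈ w → R ⊢ u ≈ w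

module _ {n : ℕ} {R : Rel2 n} where
  private
    ≡⇒≈ : ∀ {u v} → u ≡ v → R ⊢ u ≈ v
    ≡⇒≈ P.refl = refl

    congˡ : ∀ a {u v} → R ⊢ u ≈ v → R ⊢ (a ++ u) ≈ (a ++ v)
    congˡ a (step l {s} {t} r x) =
      trans (≡⇒≈ (P.sym (++-assoc a l (s ++ r))))
        (trans (step (a ++ l) r x) (≡⇒≈ (++-assoc a l (t ++ r))))
    congˡ a refl = refl
    congˡ a (sym p) = sym (congˡ a p)
    congˡ a (trans p q) = trans (congˡ a p) (congˡ a q)

    congʳ : ∀ b {u v} → R ⊢ u ≈ v → R ⊢ (u ++ b) ≈ (v ++ b)
    congʳ b (step l {s} {t} r x) =
      trans (≡⇒≈ (P.trans (++-assoc l (s ++ r) b) (P.cong (l ++_) (++-assoc s r b))))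
        (trans (step l (r ++ b) x)
          (≡⇒≈ (P.sym (P.trans (++-assoc l (t ++ r) b) (P.cong (l ++_) (++-assoc t r b))))))
    congʳ b refl = refl
    congʳ b (sym p) = sym (congʳ b p)
    congʳ b (trans p q) = trans (congʳ b p) (congʳ b q)

  presented : Monoid 0ℓ 0ℓ
  presented = record
    { Carrier  = Word n
    ; _≈_      = R ⊢_≈_
    ; _∙_      = _++_
    ; ε        = []
    ; isMonoid = record
      { isSemigroup = record
        { isMagma = record
          { isEquivalence = record { refl = refl ; sym = sym ; trans = trans }
          ; ∙-cong = λ {x} {y} {u} {v} p q → trans (congʳ u p) (congˡ y q) }
        ; assoc = λ x y z → ≡⇒≈ (++-assoc x y z) }
      ; identity = (λ x → refl) , (λ x → ≡⇒≈ (++-identityʳ x)) } }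

TietzeEquivalent : ∀ {n} → Rel2 n → Rel2 n → Set
TietzeEquivalent R S =
  ∃ λ (f : Word _ → Word _) →
    MonoidMorphisms.IsMonoidIsomorphism
      (Monoid.rawMonoid (presented {R = R}))
      (Monoid.rawMonoid (presented {R = S})) f

module Submission where

-- Both 2-polygraphs have the same 1-generators Col_1(n) and
-- share the column relations CC_2(n); they differ only in how they encode
-- plactic commutation.  Modulo CC_2(n) the two encodings are the same
-- equations: γ_{zy} rewrites c_x c_z c_y to c_x c_{zy} and γ_{zx} rewrites
-- c_z c_x c_y to c_{zx} c_y, so η^c_{x,y,z} holds iff α'_{x,zy} holds;
-- likewise ε^c_{x,y,z} holds iff α'_{y,zx} holds.  Hence every relation of
-- each polygraph is derivable in the other, the two generated congruences
-- on Col_1(n)^* coincide, and the identity of Col_1(n)^* induces an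
-- isomorphism of the presented monoids.

open import Defs
open import Data.Nat using (ℕ; _<_; z≤n; s≤s)
open import Data.Nat.Properties using (<⇒<ᵇ; ≤-<-trans; <-≤-trans)
open import Data.Bool using (true; _∧_; T)
open import Data.Fin using (Fin; toℕ)
open import Data.List using ([]; _∷_; _++_)
open import Data.List.Properties using (++-identityʳ)
open import Data.Product using (_,_)
open import Relation.Binary.PropositionalEquality using (subst₂)
open import Algebra.Bundles using (Monoid)

module _ {n : ℕ} where

  _⇛_ : Rel2 n → Rel2 n → Set
  R ⇛ S = ∀ {s t} → R s t → S ⊢ s ≈ t

  by : {R : Rel2 n} → R ⇛ R
  by {R} {s} {t} r = subst₂ (R ⊢_≈_) (++-identityʳ s) (++-identityʳ t) (step [] [] r)

  congruence-mono : {R S : Rel2 n} → R ⇛ S → ∀ {u v} → R ⊢ u ≈ v → S ⊢ u ≈ v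
  congruence-mono {S = S} R⇛S (step l r s⇒t) =
    ∙-cong (refl {u = l}) (∙-cong (R⇛S s⇒t) (refl {u = r}))
    where open Monoid (presented {n} {S}) using (∙-cong)
  congruence-mono R⇛S refl        = refl
  congruence-mono R⇛S (sym p)     = sym (congruence-mono R⇛S p)
  congruence-mono R⇛S (trans p q) = trans (congruence-mono R⇛S p) (congruence-mono R⇛S q)

  mutually-derivable⇒Tietze : {R S : Rel2 n} → R ⇛ S → S ⇛ R → TietzeEquivalent R S
  mutually-derivable⇒Tietze R⇛S S⇛R = (λ w → w) , record
    { isMonoidMonomorphism = record
      { isMonoidHomomorphism = record
        { isMagmaHomomorphism = record
          { isRelHomomorphism = record { cong = congruence-mono R⇛S }
          ; homo = λ _ _ → refl }
        ; ε-homo = refl }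
      ; injective = congruence-mono S⇛R }
    ; surjective = λ w → w , congruence-mono R⇛S }

  replace-ends : {R : Rel2 n} {a a′ b b′ : Word n} →
                 R ⊢ a ≈ a′ → R ⊢ b ≈ b′ → R ⊢ a ≈ b → R ⊢ a′ ≈ b′
  replace-ends a≈a′ b≈b′ a≈b = trans (sym a≈a′) (trans a≈b b≈b′)

  pair-isCol : (y z : Fin n) → toℕ y < toℕ z → T (isCol (z ∷ y ∷ []))
  pair-isCol y z y<z = ∧-true (<⇒<ᵇ y<z)
    where
    ∧-true : ∀ {b} → T b → T (b ∧ true)
    ∧-true {true} t = t

  merge-pair : {R : Rel2 n} → CC2 ⇛ R → (l r : Word n) (y z : Fin n)
               (zy : T (isCol (z ∷ y ∷ []))) →
               R ⊢ (l ++ (c1 z ∷ c1 y ∷ []) ++ r) ≈ (l ++ ((z ∷ y ∷ [] , zy) ∷ []) ++ r)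
  merge-pair {R} CC⇛R l r y z zy =
    ∙-cong (refl {u = l}) (∙-cong (CC⇛R (γ (z ∷ y ∷ []) zy (s≤s (s≤s z≤n)))) (refl {u = r}))
    where open Monoid (presented {n} {R}) using (∙-cong)

  -- Modulo CC_2(n), α'_{x,zy} (read backwards) is η^c_{x,y,z}: both sides
  -- of η^c merge to the two sides of α'_{x,zy}.
  module CommutationLeft {R : Rel2 n} (CC⇛R : CC2 ⇛ R) (x y z : Fin n)
                         (zy : T (isCol (z ∷ y ∷ []))) (zx : T (isCol (z ∷ x ∷ []))) where

    η⇒α'₁ : R ⊢ (c1 z ∷ c1 x ∷ c1 y ∷ []) ≈ (c1 x ∷ c1 z ∷ c1 y ∷ []) →
            R ⊢ (c1 x ∷ (z ∷ y ∷ [] , zy) ∷ []) ≈ ((z ∷ x ∷ [] , zx) ∷ c1 y ∷ [])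
    η⇒α'₁ η-holds = sym (replace-ends (merge-pair CC⇛R [] (c1 y ∷ []) x z zx)
                                       (merge-pair CC⇛R (c1 x ∷ []) [] y z zy) η-holds)

    α'₁⇒η : R ⊢ (c1 x ∷ (z ∷ y ∷ [] , zy) ∷ []) ≈ ((z ∷ x ∷ [] , zx) ∷ c1 y ∷ []) →
            R ⊢ (c1 z ∷ c1 x ∷ c1 y ∷ []) ≈ (c1 x ∷ c1 z ∷ c1 y ∷ [])
    α'₁⇒η α-holds = sym (replace-ends (sym (merge-pair CC⇛R (c1 x ∷ []) [] y z zy))
                                       (sym (merge-pair CC⇛R [] (c1 y ∷ []) x z zx)) α-holds)

  module CommutationRight {R : Rel2 n} (CC⇛R : CC2 ⇛ R) (x y z : Fin n)
                          (zx : T (isCol (z ∷ x ∷ []))) (yx : T (isCol (y ∷ x ∷ []))) where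

    ε⇒α'₂ : R ⊢ (c1 y ∷ c1 z ∷ c1 x ∷ []) ≈ (c1 y ∷ c1 x ∷ c1 z ∷ []) →
            R ⊢ (c1 y ∷ (z ∷ x ∷ [] , zx) ∷ []) ≈ ((y ∷ x ∷ [] , yx) ∷ c1 z ∷ [])
    ε⇒α'₂ = replace-ends (merge-pair CC⇛R (c1 y ∷ []) [] x z zx)
                         (merge-pair CC⇛R [] (c1 z ∷ []) x y yx)

    α'₂⇒ε : R ⊢ (c1 y ∷ (z ∷ x ∷ [] , zx) ∷ []) ≈ ((y ∷ x ∷ [] , yx) ∷ c1 z ∷ []) →
            R ⊢ (c1 y ∷ c1 z ∷ c1 x ∷ []) ≈ (c1 y ∷ c1 x ∷ c1 z ∷ [])
    α'₂⇒ε = replace-ends (sym (merge-pair CC⇛R (c1 y ∷ []) [] x z zx))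
                         (sym (merge-pair CC⇛R [] (c1 z ∷ []) x y yx))

  CC⇛Knuth : CC2 ⇛ KnuthCC2
  CC⇛Knuth γu = by (cc γu)

  CC⇛CPC : CC2 ⇛ CPC2
  CC⇛CPC γu = by (cc γu)

  CPC⇛Knuth : CPC2 ⇛ KnuthCC2
  CPC⇛Knuth (cc γu) = CC⇛Knuth γu
  CPC⇛Knuth (α'₁ x y z x≤y y<z zy zx) =
    CommutationLeft.η⇒α'₁ CC⇛Knuth x y z zy zx (by (η x y z x≤y y<z))
  CPC⇛Knuth (α'₂ x y z x<y y≤z zx yx) =
    CommutationRight.ε⇒α'₂ CC⇛Knuth x y z zx yx (by (ε x y z x<y y≤z))

  Knuth⇛CPC : KnuthCC2 ⇛ CPC2
  Knuth⇛CPC (cc γu) = CC⇛CPC γu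
  Knuth⇛CPC (η x y z x≤y y<z) =
    CommutationLeft.α'₁⇒η CC⇛CPC x y z zy zx (by (α'₁ x y z x≤y y<z zy zx))
    where
    zy : T (isCol (z ∷ y ∷ []))
    zy = pair-isCol y z y<z
    zx : T (isCol (z ∷ x ∷ []))
    zx = pair-isCol x z (≤-<-trans x≤y y<z)
  Knuth⇛CPC (ε x y z x<y y≤z) =
    CommutationRight.α'₂⇒ε CC⇛CPC x y z zx yx (by (α'₂ x y z x<y y≤z zx yx))
    where
    zx : T (isCol (z ∷ x ∷ []))
    zx = pair-isCol x z (<-≤-trans x<y y≤z)
    yx : T (isCol (y ∷ x ∷ []))
    yx = pair-isCol x y x<y

lemma2p3p5 : (n : ℕ) → 0 < n → TietzeEquivalent (CPC2 {n}) (KnuthCC2 {n})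
lemma2p3p5 n _ = mutually-derivable⇒Tietze CPC⇛Knuth Knuth⇛CPC
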